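{- For every nonnegative integer $a_1$: $G(a_1,0,0)=0$ if $a_1$ is odd and $G(a_1,0,0)=1$ if $a_1$ is even; $G(a_1,0,a_1)=1$. Moreover, $G(a_1,1,0)=a_1/2$ for even $a_1$, and $G(a_1,2,0)=\left(\frac{a_1+1}{2}\right)^2$ for odd $a_1$.
   Context: For a sequence $\mathbf c=(c_1,\dots,c_r)$ of nonnegative integers with sum $N$, blocks are the consecutive intervals of $[N]$ of lengths $c_1,\dots,c_r$, and $S_{\mathbf c}$ is the set of permutations $\pi$ of $[N]$ with $\pi_i>\pi_{i+1}$ whenever $i,i+1$ are in the same block. For nonnegative integers $a_1,a_2,s$, $G(a_1,a_2,s)$ is the sum, over all integers $m$ for which all parts are nonnegative, of the number of permutations in $S_{(a_1-m,\;a_2-(s-m),\;m,\;s-m)}$ having no fixed point ($\pi_i=i$) in the first two blocks. -}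

module Defs where

open import Data.Nat using (ℕ; zero; suc; _+_; _∸_; _<_; _≤_; _<?_; _≤?_)
open import Data.Nat.Properties using (_≟_)
open import Data.Fin using (Fin; toℕ)
open import Data.Fin.Properties using (all?) renaming (_≟_ to _≟ᶠ_)
open import Data.Vec using (Vec; []; _∷_; lookup)
open import Data.List using (List; []; _∷_; [_]; map; concatMap; filter; length; upTo; allFin)
open import Data.Nat.ListAction using (sum)
open import Relation.Binary.PropositionalEquality using (_≡_; _≢_)
open import Relation.Nullary using (Dec; ¬_; yes; no)
open import Relation.Nullary.Decidable using (¬?; _→-dec_; _×-dec_)
open import Data.Product using (_×_)

allVecs : (n k : ℕ) → List (Vec (Fin k) n)
allVecs zero    k = [ [] ]
allVecs (suc n) k = concatMap (λ x → map (x ∷_) (allVecs n k)) (allFin k)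

-- Index (0-based) of the block containing 0-based position i,
-- for the composition given by the list of block lengths.
blockOf : List ℕ → ℕ → ℕ
blockOf []       i = 0
blockOf (c ∷ cs) i with i <? c
... | yes _ = 0
... | no  _ = suc (blockOf cs (i ∸ c))

-- Positions of [N] are encoded 0-based as Fin N (position p ↔ p+1).
-- A permutation of [N] is an injective map Fin N → Fin N, stored as a vector.
IsPerm : ∀ {N} → Vec (Fin N) N → Set
IsPerm {N} π = ∀ (i j : Fin N) → lookup π i ≡ lookup π j → i ≡ j

BlockDescents : ∀ {N} → List ℕ → Vec (Fin N) N → Set
BlockDescents {N} c π = ∀ (i j : Fin N) → toℕ j ≡ suc (toℕ i) →
  blockOf c (toℕ i) ≡ blockOf c (toℕ j) → toℕ (lookup π j) < toℕ (lookup π i)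

-- No fixed point among the first L positions (L = c₁ + c₂).
NoFixedBelow : ∀ {N} → ℕ → Vec (Fin N) N → Set
NoFixedBelow {N} L π = ∀ (i : Fin N) → toℕ i < L → lookup π i ≢ i

Good : ∀ {N} → List ℕ → ℕ → Vec (Fin N) N → Set
Good c L π = IsPerm π × BlockDescents c π × NoFixedBelow L π

good? : ∀ {N} (c : List ℕ) (L : ℕ) (π : Vec (Fin N) N) → Dec (Good c L π)
good? c L π =
  all? (λ i → all? (λ j → (lookup π i ≟ᶠ lookup π j) →-dec (i ≟ᶠ j)))
  ×-dec all? (λ i → all? (λ j → (toℕ j ≟ suc (toℕ i)) →-dec
           ((blockOf c (toℕ i) ≟ blockOf c (toℕ j)) →-dec (toℕ (lookup π j) <? toℕ (lookup π i)))))
  ×-dec all? (λ i → (toℕ i <? L) →-dec ¬? (lookup π i ≟ᶠ i))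

count4 : ℕ → ℕ → ℕ → ℕ → ℕ
count4 c₁ c₂ c₃ c₄ =
  length (filter (good? (c₁ ∷ c₂ ∷ c₃ ∷ c₄ ∷ []) (c₁ + c₂)) (allVecs N N))
  where N = c₁ + c₂ + c₃ + c₄

-- Summand for m: counted only when all parts a₁-m, a₂-(s-m), m, s-m are nonnegative.
term : ℕ → ℕ → ℕ → ℕ → ℕ
term a₁ a₂ s m with m ≤? a₁ | m ≤? s | s ∸ m ≤? a₂
... | yes _ | yes _ | yes _ = count4 (a₁ ∸ m) (a₂ ∸ (s ∸ m)) m (s ∸ m)
... | _     | _     | _     = 0

-- Nonnegativity forces 0 ≤ m ≤ s, so summing over m ∈ {0,…,s} covers all m.
G : ℕ → ℕ → ℕ → ℕ
G a₁ a₂ s = sum (map (term a₁ a₂ s) (upTo (suc s)))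

module Submission where

-- For each of the four claims only one summand of G survives,
-- a composition (a, k) of two consecutive blocks of lengths a and k ≤ 2
-- (possibly preceded or followed by empty blocks).  A permutation in S_c
-- for such c is determined by its tail T, the decreasing list of its last
-- k values: its first a values must be the remaining values of [0, a + k)
-- in decreasing order (descending-prefix-level).  This is proved for
-- arbitrary k by induction on T, tracking the "level" f(i) + i + 1 of the
-- first block, which can only drop and drops once for each value of T
-- passed.  Hence the Good vectors are counted by the valid tails: those
-- decreasing lists of values below a + k whose canonical permutation has no
-- fixed point (#Good-two-blocks).  The file first relates vectors to
-- functions on ℕ and counting to listing, then develops the canonical
-- filling and the two-block counting theorem, and finally enumerates the
-- valid tails for k = 0 (the reversal), k = 1 with a = 2t (t ≤ v < 2t), and
-- k = 2 with a = 2t + 1 ((t + 1)² pairs); lemma6 assembles these.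

open import Defs
open import Data.Nat using (ℕ; _+_; _^_; _/_; _%_)
open import Data.Product using (_×_)
open import Relation.Binary.PropositionalEquality using (_≡_)

open import Data.Nat using (zero; suc; _∸_; _*_; _≤_; _<_; _>_; z≤n; s≤s; s≤s⁻¹; _≤?_; _<?_)
open import Data.Nat.Properties
open import Data.Nat.Tactic.RingSolver using (solve-∀)
open import Data.Nat.DivMod using (_mod_; m<n⇒m%n≡m; m≡m%n+[m/n]*n; m*n/n≡m)
open import Data.Nat.ListAction using (sum)
open import Data.Fin using (Fin; toℕ; fromℕ<)
open import Data.Fin.Properties using (toℕ-injective; toℕ-fromℕ<; toℕ<n)
open import Data.Vec as Vec using (Vec; []; _∷_; lookup; tabulate; toList)
open import Data.Vec.Properties using (lookup∘tabulate)
import Data.Vec.Properties as VecProperties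
open import Data.List
  using (List; []; _∷_; [_]; _++_; length; map; filter; applyUpTo; upTo; allFin; concatMap; cartesianProductWith)
open import Data.List.Properties
  using (map-upTo; length-++; length-applyUpTo; length-upTo; length-map; map-∘; map-id-local; ∷-injectiveˡ; ∷-injectiveʳ)
open import Data.List.Membership.Propositional using (_∈_; _∉_)
open import Data.List.Membership.Propositional.Properties
  using (∈-concatMap⁺; ∈-map⁺; ∈-map⁻; ∈-upTo⁺; ∈-upTo⁻; ∈-cartesianProductWith⁺; ∈-cartesianProductWith⁻;
         ∈-allFin; ∈-filter⁺; ∈-filter⁻; ∈-applyUpTo⁺; ∈-applyUpTo⁻)
open import Data.List.Membership.Propositional.Properties.WithK using (unique∧set⇒bag)
open import Data.List.Relation.Unary.Any as Any using (here; there)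
open import Data.List.Relation.Unary.All as All using (All; []; _∷_)
open import Data.List.Relation.Unary.All.Properties using (applyUpTo⁺₁)
open import Data.List.Relation.Unary.AllPairs using ([]; _∷_)
open import Data.List.Relation.Unary.Linked as Linked using (Linked; []; [-]; _∷_)
open import Data.List.Relation.Unary.Linked.Properties using (Linked⇒All)
open import Data.List.Relation.Unary.Unique.Propositional using (Unique)
import Data.List.Relation.Unary.Unique.Propositional.Properties as Unique
open import Data.List.Relation.Binary.BagAndSetEquality using (∼bag⇒↭)
open import Data.List.Relation.Binary.Permutation.Propositional.Properties using (↭-length)
open import Data.Product using (_,_; proj₁; proj₂; ∃)
open import Data.Sum using (_⊎_; inj₁; inj₂; [_,_]′)
open import Data.Empty using (⊥-elim)
open import Function.Base using (flip)
open import Function.Bundles using (mk⇔)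
open import Relation.Binary using (tri<; tri≈; tri>)
open import Relation.Binary.PropositionalEquality
  using (_≢_; refl; sym; trans; cong; cong₂; subst; subst₂; module ≡-Reasoning)
open import Relation.Nullary using (¬_; Dec; yes; no)

-- The r-th entry of a list of naturals (0 past its end).
entry : List ℕ → ℕ → ℕ
entry []       _       = 0
entry (x ∷ xs) zero    = x
entry (x ∷ xs) (suc r) = entry xs r

entry-applyUpTo : ∀ (g : ℕ → ℕ) n r → r < n → entry (applyUpTo g n) r ≡ g r
entry-applyUpTo g (suc n) zero    _         = refl
entry-applyUpTo g (suc n) (suc r) (s≤s r<n) = entry-applyUpTo (λ r → g (suc r)) n r r<n

applyUpTo-entry : ∀ T → applyUpTo (entry T) (length T) ≡ T
applyUpTo-entry []      = refl
applyUpTo-entry (x ∷ T) = cong (x ∷_) (applyUpTo-entry T)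

entry-∈ : ∀ T r → r < length T → entry T r ∈ T
entry-∈ (x ∷ T) zero    _         = here refl
entry-∈ (x ∷ T) (suc r) (s≤s r<n) = there (entry-∈ T r r<n)

nth : ∀ {N n} → Vec (Fin N) n → ℕ → ℕ
nth z = entry (toList (Vec.map toℕ z))

nth-lookup : ∀ {N n} (z : Vec (Fin N) n) i → nth z (toℕ i) ≡ toℕ (lookup z i)
nth-lookup (x ∷ z) Fin.zero    = refl
nth-lookup (x ∷ z) (Fin.suc i) = nth-lookup z i

nth-ext : ∀ {N n} (z w : Vec (Fin N) n) → (∀ i → i < n → nth z i ≡ nth w i) → z ≡ w
nth-ext []      []      _    = refl
nth-ext (x ∷ z) (y ∷ w) same =
  cong₂ _∷_ (toℕ-injective (same 0 (s≤s z≤n))) (nth-ext z w (λ i i<n → same (suc i) (s≤s i<n)))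

-- The vector of length N with entries g 0, …, g (N-1), each reduced mod N;
-- when g maps [0,N) into [0,N) it is g itself.
vecOf : ∀ N → (ℕ → ℕ) → Vec (Fin N) N
vecOf zero    g = []
vecOf (suc M) g = tabulate (λ i → g (toℕ i) mod suc M)

nth-vecOf : ∀ N g i → i < N → g i < N → nth (vecOf N g) i ≡ g i
nth-vecOf (suc M) g i i<N gi<N = begin
  nth (vecOf (suc M) g) i                   ≡⟨ cong (nth (vecOf (suc M) g)) (sym (toℕ-fromℕ< i<N)) ⟩
  nth (vecOf (suc M) g) (toℕ (fromℕ< i<N))  ≡⟨ nth-lookup (vecOf (suc M) g) (fromℕ< i<N) ⟩
  toℕ (lookup (vecOf (suc M) g) (fromℕ< i<N)) ≡⟨ cong toℕ (lookup∘tabulate (λ j → g (toℕ j) mod suc M) (fromℕ< i<N)) ⟩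
  toℕ (g (toℕ (fromℕ< i<N)) mod suc M)      ≡⟨ cong (λ j → toℕ (g j mod suc M)) (toℕ-fromℕ< i<N) ⟩
  toℕ (g i mod suc M)                       ≡⟨ toℕ-fromℕ< _ ⟩
  g i % suc M                               ≡⟨ m<n⇒m%n≡m gi<N ⟩
  g i                                       ∎
  where open ≡-Reasoning

nth<N : ∀ {N n} (z : Vec (Fin N) n) i → i < n → nth z i < N
nth<N (x ∷ z) zero    _         = toℕ<n x
nth<N (x ∷ z) (suc i) (s≤s i<n) = nth<N z i i<n

InjectiveBelow : ℕ → (ℕ → ℕ) → Set
InjectiveBelow N f = ∀ i j → i < N → j < N → f i ≡ f j → i ≡ j

DescentsBelow : List ℕ → ℕ → (ℕ → ℕ) → Set
DescentsBelow c N f = ∀ i → suc i < N → blockOf c i ≡ blockOf c (suc i) → f (suc i) < f i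

FixedPointFreeBelow : ℕ → ℕ → (ℕ → ℕ) → Set
FixedPointFreeBelow L N f = ∀ i → i < N → i < L → f i ≢ i

GoodFun : List ℕ → ℕ → ℕ → (ℕ → ℕ) → Set
GoodFun c L N f = InjectiveBelow N f × DescentsBelow c N f × FixedPointFreeBelow L N f

goodFun-cong : ∀ {c L N f g} → (∀ i → i < N → f i ≡ g i) → GoodFun c L N g → GoodFun c L N f
goodFun-cong {f = f} {g} f≗g (inj , desc , nofix) =
  (λ i j i<N j<N fi≡fj → inj i j i<N j<N (trans (sym (f≗g i i<N)) (trans fi≡fj (f≗g j j<N)))) ,
  (λ i i+1<N same → subst₂ _<_ (sym (f≗g (suc i) i+1<N)) (sym (f≗g i (<-trans (n<1+n i) i+1<N)))
                      (desc i i+1<N same)) ,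
  (λ i i<N i<L fi≡i → nofix i i<N i<L (trans (sym (f≗g i i<N)) fi≡i))

module _ {c : List ℕ} {L N : ℕ} where

  good⇒goodFun : (z : Vec (Fin N) N) → Good c L z → GoodFun c L N (nth z)
  good⇒goodFun z (perm , desc , nofix) = inj , desc′ , nofix′
    where
    at : ∀ i (i<N : i < N) → nth z i ≡ toℕ (lookup z (fromℕ< i<N))
    at i i<N = trans (cong (nth z) (sym (toℕ-fromℕ< i<N))) (nth-lookup z (fromℕ< i<N))
    inj : InjectiveBelow N (nth z)
    inj i j i<N j<N eq = begin
      i                     ≡⟨ toℕ-fromℕ< i<N ⟨
      toℕ (fromℕ< i<N)      ≡⟨ cong toℕ (perm _ _ (toℕ-injective (trans (sym (at i i<N)) (trans eq (at j j<N))))) ⟩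
      toℕ (fromℕ< j<N)      ≡⟨ toℕ-fromℕ< j<N ⟩
      j                     ∎
      where open ≡-Reasoning
    desc′ : DescentsBelow c N (nth z)
    desc′ i i+1<N same = subst₂ _<_ (sym (at (suc i) i+1<N)) (sym (at i i<N))
      (desc (fromℕ< i<N) (fromℕ< i+1<N)
            (trans (toℕ-fromℕ< i+1<N) (cong suc (sym (toℕ-fromℕ< i<N))))
            (subst₂ (λ x y → blockOf c x ≡ blockOf c y) (sym (toℕ-fromℕ< i<N)) (sym (toℕ-fromℕ< i+1<N)) same))
      where
      i<N : i < N
      i<N = <-trans (n<1+n i) i+1<N
    nofix′ : FixedPointFreeBelow L N (nth z)
    nofix′ i i<N i<L fixed = nofix (fromℕ< i<N) (subst (_< L) (sym (toℕ-fromℕ< i<N)) i<L)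
      (toℕ-injective (trans (sym (at i i<N)) (trans fixed (sym (toℕ-fromℕ< i<N)))))

  goodFun⇒good : (z : Vec (Fin N) N) → GoodFun c L N (nth z) → Good c L z
  goodFun⇒good z (inj , desc , nofix) = perm , desc′ , nofix′
    where
    perm : IsPerm z
    perm i j eq = toℕ-injective (inj (toℕ i) (toℕ j) (toℕ<n i) (toℕ<n j)
      (trans (nth-lookup z i) (trans (cong toℕ eq) (sym (nth-lookup z j)))))
    desc′ : BlockDescents c z
    desc′ i j j≡i+1 same = subst₂ _<_ (nth-lookup z j) (nth-lookup z i)
      (subst (λ x → nth z x < nth z (toℕ i)) (sym j≡i+1)
        (desc (toℕ i) (subst (_< N) j≡i+1 (toℕ<n j)) (subst (λ x → blockOf c (toℕ i) ≡ blockOf c x) j≡i+1 same)))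
    nofix′ : NoFixedBelow L z
    nofix′ i i<L fixed = nofix (toℕ i) (toℕ<n i) i<L (trans (nth-lookup z i) (cong toℕ fixed))

  vecOf-good : ∀ f → (∀ i → i < N → f i < N) → GoodFun c L N f → Good c L (vecOf N f)
  vecOf-good f bounded good =
    goodFun⇒good (vecOf N f) (goodFun-cong {c = c} {L} (λ i i<N → nth-vecOf N f i i<N (bounded i i<N)) good)

allVecs-complete : ∀ n k (z : Vec (Fin k) n) → z ∈ allVecs n k
allVecs-complete zero    k []      = here refl
allVecs-complete (suc n) k (x ∷ z) =
  ∈-concatMap⁺ (λ y → map (y ∷_) (allVecs n k)) (Any.map (λ { refl → ∈-map⁺ (x ∷_) (allVecs-complete n k z) }) (∈-allFin x))

concatMap-map≡cartesianProductWith : ∀ {A B C : Set} (f : A → B → C) xs ys →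
  concatMap (λ x → map (f x) ys) xs ≡ cartesianProductWith f xs ys
concatMap-map≡cartesianProductWith f []       ys = refl
concatMap-map≡cartesianProductWith f (x ∷ xs) ys =
  cong (map (f x) ys ++_) (concatMap-map≡cartesianProductWith f xs ys)

allVecs-unique : ∀ n k → Unique (allVecs n k)
allVecs-unique zero    k = [] ∷ []
allVecs-unique (suc n) k =
  subst Unique (sym (concatMap-map≡cartesianProductWith _∷_ (allFin k) (allVecs n k)))
    (Unique.cartesianProductWith⁺ _∷_ (λ eq → VecProperties.∷-injectiveˡ eq , VecProperties.∷-injectiveʳ eq)
      (Unique.allFin⁺ k) (allVecs-unique n k))

#Good : List ℕ → ℕ → ℕ → ℕ
#Good c L N = length (filter (good? c L) (allVecs N N))

#Good-by-listing : ∀ {c L N} (ys : List (Vec (Fin N) N)) → Unique ys →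
  (∀ z → z ∈ ys → Good c L z) → (∀ z → Good c L z → z ∈ ys) → #Good c L N ≡ length ys
#Good-by-listing {c} {L} {N} ys unique sound complete =
  ↭-length (∼bag⇒↭ (unique∧set⇒bag (Unique.filter⁺ (good? c L) (allVecs-unique N N)) unique
    (mk⇔ (λ z∈ → complete _ (proj₂ (∈-filter⁻ (good? c L) {xs = allVecs N N} z∈)))
         (λ z∈ → ∈-filter⁺ (good? c L) (allVecs-complete N N _) (sound _ z∈)))))

Descending : ℕ → (ℕ → ℕ) → Set
Descending n g = ∀ i → suc i < n → g (suc i) < g i

module _ {n : ℕ} {g : ℕ → ℕ} (desc : Descending n g) where

  descent-gap : ∀ i d → i + d < n → g (i + d) + d ≤ g i
  descent-gap i zero    i<n rewrite +-identityʳ i | +-identityʳ (g i) = ≤-refl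
  descent-gap i (suc d) i+d+1<n rewrite +-suc i d | +-suc (g (suc (i + d))) d =
    ≤-trans (+-monoˡ-≤ d (desc (i + d) i+d+1<n)) (descent-gap i d (<-trans (n<1+n (i + d)) i+d+1<n))

  descending-< : ∀ {i j} → i < j → j < n → g j < g i
  descending-< {i} i<j j<n with m≤n⇒∃[o]m+o≡n i<j
  ... | d , refl = <-≤-trans (m<m+n (g (suc (i + d))) (s≤s z≤n))
    (subst (λ k → g k + suc d ≤ g i) (+-suc i d) (descent-gap i (suc d) (subst (_< n) (sym (+-suc i d)) j<n)))

  descending-injective : InjectiveBelow n g
  descending-injective i j i<n j<n gi≡gj with <-cmp i j
  ... | tri< i<j _ _ = ⊥-elim (<-irrefl (sym gi≡gj) (descending-< i<j j<n))
  ... | tri≈ _ i≡j _ = i≡j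
  ... | tri> _ _ j<i = ⊥-elim (<-irrefl gi≡gj (descending-< j<i i<n))

  descent-level : ∀ {i j} → i ≤ j → j < n → g j + j ≤ g i + i
  descent-level {i} i≤j j<n with m≤n⇒∃[o]m+o≡n i≤j
  ... | d , refl = begin
    g (i + d) + (i + d) ≡⟨ cong (g (i + d) +_) (+-comm i d) ⟩
    g (i + d) + (d + i) ≡⟨ +-assoc (g (i + d)) d i ⟨
    g (i + d) + d + i   ≤⟨ +-monoˡ-≤ i (descent-gap i d j<n) ⟩
    g i + i             ∎
    where open ≤-Reasoning

  -- … and stays at least n - 1, since the last value is non-negative.
  descent-floor : ∀ {i} → i < n → n ≤ suc (g i + i)
  descent-floor {i} i<n = begin
    n                   ≡⟨ m∸n+n≡m i<n ⟨
    d + suc i           ≤⟨ +-monoˡ-≤ (suc i) (≤-trans (m≤n+m d (g (i + d))) (descent-gap i d i+d<n)) ⟩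
    g i + suc i         ≡⟨ +-suc (g i) i ⟩
    suc (g i + i)       ∎
    where
    open ≤-Reasoning
    d : ℕ
    d = n ∸ suc i
    i+d<n : i + d < n
    i+d<n = ≤-reflexive (trans (cong suc (+-comm i d)) (trans (sym (+-suc d i)) (m∸n+n≡m i<n)))

-- The canonical filling: positions 0, …, a-1 receive, in decreasing order,
-- the values of [0, a + |T|) not in the decreasing list T.  Position i gets
-- level a T i ∸ suc i, where the level starts at a + |T| and drops by one
-- for each value of T already passed; the largest value t of T is still
-- above position i exactly when suc (i + t) is below the current level.

level : ℕ → List ℕ → ℕ → ℕ
level a []      i = a
level a (t ∷ T) i with suc (i + t) <? a + length (t ∷ T)
... | yes _ = a + length (t ∷ T)
... | no  _ = level a T i

fill : ℕ → List ℕ → ℕ → ℕ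
fill a T i = level a T i ∸ suc i

module _ (a t : ℕ) (T : List ℕ) (i : ℕ) where

  LevelCase : Set
  LevelCase = (suc (i + t) < a + length (t ∷ T) × level a (t ∷ T) i ≡ a + length (t ∷ T))
            ⊎ (a + length (t ∷ T) ≤ suc (i + t) × level a (t ∷ T) i ≡ level a T i)

  level-top : suc (i + t) < a + length (t ∷ T) → level a (t ∷ T) i ≡ a + length (t ∷ T)
  level-top above with suc (i + t) <? a + length (t ∷ T)
  ... | yes _     = refl
  ... | no  below = ⊥-elim (below above)

  level-rest : a + length (t ∷ T) ≤ suc (i + t) → level a (t ∷ T) i ≡ level a T i
  level-rest below with suc (i + t) <? a + length (t ∷ T)
  ... | yes above = ⊥-elim (<⇒≱ above below)
  ... | no  _     = refl

  level-cases : LevelCase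
  level-cases = by-cases (suc (i + t) <? a + length (t ∷ T))
    where
    by-cases : Dec (suc (i + t) < a + length (t ∷ T)) → LevelCase
    by-cases (yes above) = inj₁ (above , level-top above)
    by-cases (no below)  = inj₂ (≮⇒≥ below , level-rest (≮⇒≥ below))

level-≥ : ∀ a T i → a ≤ level a T i
level-≥ a []      i = ≤-refl
level-≥ a (t ∷ T) i with suc (i + t) <? a + length (t ∷ T)
... | yes _ = m≤m+n a (length (t ∷ T))
... | no  _ = level-≥ a T i

level-≤ : ∀ a T i → level a T i ≤ a + length T
level-≤ a []      i = ≤-reflexive (sym (+-identityʳ a))
level-≤ a (t ∷ T) i with suc (i + t) <? a + length (t ∷ T)
... | yes _ = ≤-refl
... | no  _ = ≤-trans (level-≤ a T i) (+-monoʳ-≤ a (n≤1+n (length T)))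

level-antitone : ∀ a T {i j} → i ≤ j → level a T j ≤ level a T i
level-antitone a []      i≤j = ≤-refl
level-antitone a (t ∷ T) {i} {j} i≤j
  with suc (j + t) <? a + length (t ∷ T) | suc (i + t) <? a + length (t ∷ T)
... | yes _ | yes _ = ≤-refl
... | yes j-above | no i-below = ⊥-elim (i-below (≤-<-trans (s≤s (+-monoˡ-≤ t i≤j)) j-above))
... | no  _ | yes _ = ≤-trans (level-≤ a T j) (+-monoʳ-≤ a (n≤1+n (length T)))
... | no  _ | no  _ = level-antitone a T i≤j

level-shift : ∀ p a T i → level (p + a) T (p + i) ≡ p + level a T i
level-shift p a []      i = refl
level-shift p a (t ∷ T) i with suc (i + t) <? a + length (t ∷ T)
... | yes above = trans (level-top (p + a) t T (p + i) (shift-< above)) (+-assoc p a _)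
  where
  shift-< : suc (i + t) < a + length (t ∷ T) → suc (p + i + t) < p + a + length (t ∷ T)
  shift-< lt = subst₂ _<_ (trans (+-suc p (i + t)) (cong suc (sym (+-assoc p i t)))) (sym (+-assoc p a _))
                 (+-monoʳ-< p lt)
... | no below = trans (level-rest (p + a) t T (p + i) (shift-≤ (≮⇒≥ below))) (level-shift p a T i)
  where
  shift-≤ : a + length (t ∷ T) ≤ suc (i + t) → p + a + length (t ∷ T) ≤ suc (p + i + t)
  shift-≤ le = subst₂ _≤_ (sym (+-assoc p a _)) (trans (+-suc p (i + t)) (cong suc (sym (+-assoc p i t))))
                 (+-monoʳ-≤ p le)

linked-below-head : ∀ {t T} → Linked _>_ (t ∷ T) → All (_< t) T
linked-below-head [-]           = []
linked-below-head (t>t′ ∷ rest) = Linked⇒All (flip <-trans) t>t′ rest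

linked-length : ∀ {t T} → Linked _>_ (t ∷ T) → length T ≤ t
linked-length [-]           = z≤n
linked-length (t>t′ ∷ rest) = ≤-<-trans (linked-length rest) t>t′

∉-above : ∀ {x T} → All (_< x) T → x ∉ T
∉-above below x∈T = <-irrefl refl (All.lookup below x∈T)

value-from-level : ∀ {x i M} → suc (x + i) ≡ M → x ≡ M ∸ suc i
value-from-level {x} {i} refl = sym (m+n∸n≡m x i)

level-from-value : ∀ {i M} → i < M → suc (M ∸ suc i + i) ≡ M
level-from-value {i} {M} i<M = trans (sym (+-suc (M ∸ suc i) i)) (m∸n+n≡m i<M)

fill-level : ∀ a T {i} → i < a → suc (fill a T i + i) ≡ level a T i
fill-level a T {i} i<a = level-from-value (≤-trans i<a (level-≥ a T i))

fill-descending : ∀ a T → Descending a (fill a T)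
fill-descending a T i i+1<a = +-cancelʳ-≤ i (suc (fill a T (suc i))) (fill a T i) (s≤s⁻¹ (begin-strict
  suc (fill a T (suc i)) + i   ≡⟨ +-suc (fill a T (suc i)) i ⟨
  fill a T (suc i) + suc i     <⟨ n<1+n _ ⟩
  suc (fill a T (suc i) + suc i) ≡⟨ fill-level a T i+1<a ⟩
  level a T (suc i)            ≤⟨ level-antitone a T (n≤1+n i) ⟩
  level a T i                  ≡⟨ fill-level a T (<-trans (n<1+n i) i+1<a) ⟨
  suc (fill a T i + i)         ∎))
  where open ≤-Reasoning

fill-avoids : ∀ a T {i} → Linked _>_ T → i < a → fill a T i ∉ T
fill-avoids a []      _      _   ()
fill-avoids a (t ∷ T) {i} sorted i<a with level-cases a t T i
... | inj₁ (above , top) = subst (_∉ t ∷ T) (sym (cong (_∸ suc i) top))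
                             (∉-above (Linked⇒All (flip <-trans) t<x sorted))
  where
  x : ℕ
  x = a + length (t ∷ T) ∸ suc i
  t<x : t < x
  t<x = +-cancelˡ-< i t x (subst (i + t <_) (+-comm x i) (≤-pred (subst (suc (i + t) <_)
          (sym (level-from-value (≤-<-trans (≤-trans (m≤m+n i t) (n≤1+n _)) above))) above)))
... | inj₂ (below , rest) = subst (_∉ t ∷ T) (sym (cong (_∸ suc i) rest))
                   λ { (here x≡t) → <-irrefl x≡t x<t
                     ; (there x∈T) → fill-avoids a T (Linked.tail sorted) i<a x∈T }
  where
  x : ℕ
  x = fill a T i
  x<t : x < t
  x<t = +-cancelˡ-< i x t (≤-pred (begin
    suc (suc (i + x))     ≡⟨ cong suc (trans (cong suc (+-comm i x)) (fill-level a T i<a)) ⟩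
    suc (level a T i)     ≤⟨ s≤s (level-≤ a T i) ⟩
    suc (a + length T)    ≡⟨ +-suc a (length T) ⟨
    a + length (t ∷ T)    ≤⟨ below ⟩
    suc (i + t)           ∎))
    where open ≤-Reasoning

level-hits : ∀ a T {x} → All (_< x) T → x < a + length T →
  level a T (a + length T ∸ suc x) ≡ a + length T
level-hits a []      _         _   = sym (+-identityʳ a)
level-hits a (t ∷ T) {x} (t<x ∷ _) x<N = level-top a t T l (begin-strict
  suc (l + t)   ≡⟨ +-suc l t ⟨
  l + suc t     ≤⟨ +-monoʳ-≤ l t<x ⟩
  l + x         <⟨ +-monoʳ-< l (n<1+n x) ⟩
  l + suc x     ≡⟨ m∸n+n≡m x<N ⟩
  a + length (t ∷ T) ∎)
  where
  open ≤-Reasoning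
  l : ℕ
  l = a + length (t ∷ T) ∸ suc x

record DescendingPrefix (a : ℕ) (T : List ℕ) (f : ℕ → ℕ) : Set where
  field
    descending : Descending a f
    bounded    : ∀ i → i < a → suc (f i + i) ≤ a + length T
    avoids     : ∀ i → i < a → f i ∉ T

equal-levels : ∀ {x y l} → suc (x + l) ≡ suc (y + l) → x ≡ y
equal-levels {x} {y} {l} eq = +-cancelʳ-≡ l x y (suc-injective eq)

cancel-prefix : ∀ {i a n x} → i ≤ a → i + x < a + n → x < a ∸ i + n
cancel-prefix {i} {a} {n} {x} i≤a lt = +-cancelˡ-< i x (a ∸ i + n)
  (subst (i + x <_) (trans (cong (_+ n) (sym (m+[n∸m]≡n i≤a))) (+-assoc i (a ∸ i) n)) lt)

shift-level : ∀ p x l → p + suc (x + l) ≡ suc (x + (p + l))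
shift-level = solve-∀

shift-prefix : ∀ {a t T f p} → DescendingPrefix a (t ∷ T) f → p < a →
  suc (f p + p) < a + length (t ∷ T) → DescendingPrefix (a ∸ p) T (λ l → f (p + l))
shift-prefix {a} {t} {T} {f} {p} P p<a dropped = record
  { descending = λ l l+1<a′ → subst (λ k → f k < f (p + l)) (sym (+-suc p l))
                                 (descending (p + l) (subst (_< a) (+-suc p l) (inside (suc l) l+1<a′)))
  ; bounded    = λ l l<a′ → +-cancelˡ-≤ p _ _ (begin
      p + suc (f (p + l) + l)  ≡⟨ shift-level p (f (p + l)) l ⟩
      suc (f (p + l) + (p + l)) ≤⟨ s≤s (descent-level descending (m≤m+n p l) (inside l l<a′)) ⟩
      suc (f p + p)            ≤⟨ ≤-pred (subst (suc (f p + p) <_) (+-suc a (length T)) dropped) ⟩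
      a + length T             ≡⟨ cong (_+ length T) (m+[n∸m]≡n (<⇒≤ p<a)) ⟨
      p + (a ∸ p) + length T   ≡⟨ +-assoc p (a ∸ p) (length T) ⟩
      p + (a ∸ p + length T)   ∎)
  ; avoids     = λ l l<a′ fpl∈T → avoids (p + l) (inside l l<a′) (there fpl∈T)
  }
  where
  open DescendingPrefix P
  open ≤-Reasoning
  inside : ∀ l → l < a ∸ p → p + l < a
  inside l l<a′ = subst (p + l <_) (m+[n∸m]≡n (<⇒≤ p<a)) (+-monoʳ-< p l<a′)

-- The induction step of descending-prefix-level below: the statement for
-- t ∷ T, assuming it for T.
module PrefixStep {t : ℕ} {T : List ℕ} (sorted : Linked _>_ (t ∷ T))
  (for-T : ∀ {a f} → All (_< a + length T) T → DescendingPrefix a T f →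
           ∀ {i} → i < a → suc (f i + i) ≡ level a T i)
  {a : ℕ} {f : ℕ → ℕ} (bound : All (_< a + length (t ∷ T)) (t ∷ T))
  (P : DescendingPrefix a (t ∷ T) f) where

  open DescendingPrefix P

  N : ℕ
  N = a + length (t ∷ T)

  -- While t is still above position i, f takes the top value there: a drop
  -- would leave f, as a prefix for T, no way to skip t.
  stays-on-top : ∀ {i} → i < a → suc (i + t) < N → suc (f i + i) ≡ N
  stays-on-top {i} i<a above with m≤n⇒m<n∨m≡n (bounded i i<a)
  ... | inj₂ on-top  = on-top
  ... | inj₁ dropped = ⊥-elim (avoids (i + l) i+l<a (here f-hits-t))
    where
    a′ : ℕ
    a′ = a ∸ i
    t<N′ : t < a′ + length T
    t<N′ = cancel-prefix (<⇒≤ i<a) (≤-pred (subst (suc (i + t) <_) (+-suc a (length T)) above))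
    l : ℕ
    l = a′ + length T ∸ suc t
    l<a′ : l < a′
    l<a′ = +-cancelʳ-≤ t (suc l) a′ (begin
      suc l + t          ≡⟨ +-suc l t ⟨
      l + suc t          ≡⟨ m∸n+n≡m t<N′ ⟩
      a′ + length T      ≤⟨ +-monoʳ-≤ a′ (linked-length sorted) ⟩
      a′ + t             ∎)
      where open ≤-Reasoning
    i+l<a : i + l < a
    i+l<a = subst (i + l <_) (m+[n∸m]≡n (<⇒≤ i<a)) (+-monoʳ-< i l<a′)
    f-hits-t : f (i + l) ≡ t
    f-hits-t = equal-levels (begin
      suc (f (i + l) + l)  ≡⟨ for-T (All.map (λ x<t → <-trans x<t t<N′) (linked-below-head sorted))
                                   (shift-prefix P i<a dropped) l<a′ ⟩
      level a′ T l         ≡⟨ level-hits a′ T (linked-below-head sorted) t<N′ ⟩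
      a′ + length T        ≡⟨ level-from-value t<N′ ⟨
      suc (l + t)          ≡⟨ cong suc (+-comm l t) ⟩
      suc (t + l)          ∎)
      where open ≡-Reasoning

  -- Once t is passed, f is the filling for T, shifted to start at the
  -- position p where t would have been the top value.
  follows-T : ∀ {i} → i < a → N ≤ suc (i + t) → suc (f i + i) ≡ level a T i
  follows-T {i} i<a below = begin
    suc (f i + i)                 ≡⟨ cong (λ k → suc (f k + k)) (m+[n∸m]≡n p≤i) ⟨
    suc (f (p + l) + (p + l))     ≡⟨ shift-level p (f (p + l)) l ⟨
    p + suc (f (p + l) + l)       ≡⟨ cong (p +_) (for-T T-bound (shift-prefix P p<a dropped) l<a′) ⟩
    p + level (a ∸ p) T l         ≡⟨ level-shift p (a ∸ p) T l ⟨
    level (p + (a ∸ p)) T (p + l) ≡⟨ cong₂ (λ b k → level b T k) (m+[n∸m]≡n (<⇒≤ p<a)) (m+[n∸m]≡n p≤i) ⟩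
    level a T i                   ∎
    where
    open ≡-Reasoning
    t<N : t < N
    t<N = All.head bound
    p : ℕ
    p = N ∸ suc t
    l : ℕ
    l = i ∸ p
    p+t : p + suc t ≡ N
    p+t = m∸n+n≡m t<N
    p≤i : p ≤ i
    p≤i = +-cancelʳ-≤ (suc t) p i (subst₂ _≤_ (sym p+t) (sym (+-suc i t)) below)
    p<a : p < a
    p<a = ≤-<-trans p≤i i<a
    l<a′ : l < a ∸ p
    l<a′ = ∸-monoˡ-< i<a p≤i
    dropped : suc (f p + p) < N
    dropped = ≤∧≢⇒< (bounded p p<a) λ on-top → avoids p p<a (here (equal-levels
      (trans on-top (trans (sym p+t) (trans (+-suc p t) (cong suc (+-comm p t)))))))
    T-bound : All (_< a ∸ p + length T) T
    T-bound = subst (λ M → All (_< M) T) (sym N′≡t) (linked-below-head sorted)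
      where
      N′≡t : a ∸ p + length T ≡ t
      N′≡t = +-cancelˡ-≡ p (a ∸ p + length T) t (suc-injective (begin
        suc (p + (a ∸ p + length T)) ≡⟨ cong suc (+-assoc p (a ∸ p) (length T)) ⟨
        suc (p + (a ∸ p) + length T) ≡⟨ cong (λ b → suc (b + length T)) (m+[n∸m]≡n (<⇒≤ p<a)) ⟩
        suc (a + length T)           ≡⟨ +-suc a (length T) ⟨
        N                            ≡⟨ p+t ⟨
        p + suc t                    ≡⟨ +-suc p t ⟩
        suc (p + t)                  ∎))

descending-prefix-level : ∀ T → Linked _>_ T → ∀ {a f} → All (_< a + length T) T →
  DescendingPrefix a T f → ∀ {i} → i < a → suc (f i + i) ≡ level a T i
descending-prefix-level []      _ {a} {f} _ P {i} i<a =
  ≤-antisym (subst (suc (f i + i) ≤_) (+-identityʳ a) (bounded i i<a)) (descent-floor descending i<a)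
  where open DescendingPrefix P
descending-prefix-level (t ∷ T) sorted {a} bound P {i} i<a with level-cases a t T i
... | inj₁ (above , top) =
  trans (PrefixStep.stays-on-top sorted (descending-prefix-level T (Linked.tail sorted)) bound P i<a above) (sym top)
... | inj₂ (below , rest) =
  trans (PrefixStep.follows-T sorted (descending-prefix-level T (Linked.tail sorted)) bound P i<a below) (sym rest)

canonical : ℕ → List ℕ → ℕ → ℕ
canonical a T i with i <? a
... | yes _ = fill a T i
... | no  _ = entry T (i ∸ a)

position : ∀ a i → i < a ⊎ ∃ λ r → a + r ≡ i
position a i with i <? a
... | yes i<a = inj₁ i<a
... | no  i≮a = inj₂ (m≤n⇒∃[o]m+o≡n (≮⇒≥ i≮a))

canonical-head : ∀ a T {i} → i < a → canonical a T i ≡ fill a T i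
canonical-head a T {i} i<a with i <? a
... | yes _  = refl
... | no i≮a = ⊥-elim (i≮a i<a)

canonical-tail : ∀ a T r → canonical a T (a + r) ≡ entry T r
canonical-tail a T r with a + r <? a
... | yes a+r<a = ⊥-elim (m+n≮m a r a+r<a)
... | no  _     = cong (entry T) (m+n∸m≡n a r)

entry-descending : ∀ {T} → Linked _>_ T → Descending (length T) (entry T)
entry-descending (t>t′ ∷ _)    zero    _           = t>t′
entry-descending (_    ∷ rest) (suc r) (s≤s r+1<n) = entry-descending rest r r+1<n
entry-descending [-]           zero    (s≤s ())

record TwoBlocks (c : List ℕ) (a N : ℕ) : Set where
  field
    first-block  : ∀ i → suc i < a → blockOf c i ≡ blockOf c (suc i)
    second-block : ∀ i → a ≤ i → suc i < N → blockOf c i ≡ blockOf c (suc i)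
    boundary     : ∀ i → suc i ≡ a → suc i < N → blockOf c i ≢ blockOf c (suc i)

-- T (with k entries) is the tail of a good permutation whose first block
-- has length a: decreasing, values below a + k, and the canonical function
-- has no fixed point below L.
record ValidTail (a k L : ℕ) (T : List ℕ) : Set where
  field
    length-tail      : length T ≡ k
    decreasing       : Linked _>_ T
    tail-bounded     : All (_< a + k) T
    fixed-point-free : FixedPointFreeBelow L (a + k) (canonical a T)

module Canonical {c a k L T} (blocks : TwoBlocks c a (a + k)) (valid : ValidTail a k L T) where

  open TwoBlocks blocks
  open ValidTail valid

  N : ℕ
  N = a + k

  entry<N : ∀ r → r < k → entry T r < N
  entry<N r r<k = All.lookup tail-bounded (entry-∈ T r (subst (r <_) (sym length-tail) r<k))

  bounded : ∀ i → i < N → canonical a T i < N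
  bounded i i<N with position a i
  ... | inj₁ i<a = subst₂ _<_ (sym (canonical-head a T i<a)) (cong (a +_) length-tail) (begin-strict
        fill a T i           ≤⟨ m≤m+n (fill a T i) i ⟩
        fill a T i + i       <⟨ n<1+n _ ⟩
        suc (fill a T i + i) ≡⟨ fill-level a T i<a ⟩
        level a T i          ≤⟨ level-≤ a T i ⟩
        a + length T         ∎)
    where open ≤-Reasoning
  ... | inj₂ (r , refl) = subst (_< N) (sym (canonical-tail a T r)) (entry<N r (+-cancelˡ-< a r k i<N))

  in-tail : ∀ {r} → a + r < N → r < length T
  in-tail {r} a+r<N = subst (r <_) (sym length-tail) (+-cancelˡ-< a r k a+r<N)

  injective : InjectiveBelow N (canonical a T)
  injective i j i<N j<N eq with position a i | position a j
  ... | inj₁ i<a | inj₁ j<a = descending-injective (fill-descending a T) i j i<a j<a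
        (trans (sym (canonical-head a T i<a)) (trans eq (canonical-head a T j<a)))
  ... | inj₁ i<a | inj₂ (r , refl) = ⊥-elim (fill-avoids a T decreasing i<a
        (subst (_∈ T) (trans (sym (canonical-tail a T r)) (trans (sym eq) (canonical-head a T i<a)))
          (entry-∈ T r (in-tail j<N))))
  ... | inj₂ (r , refl) | inj₁ j<a = ⊥-elim (fill-avoids a T decreasing j<a
        (subst (_∈ T) (trans (sym (canonical-tail a T r)) (trans eq (canonical-head a T j<a)))
          (entry-∈ T r (in-tail i<N))))
  ... | inj₂ (r , refl) | inj₂ (r′ , refl) = cong (a +_)
        (descending-injective (entry-descending decreasing) r r′ (in-tail i<N) (in-tail j<N)
          (trans (sym (canonical-tail a T r)) (trans eq (canonical-tail a T r′))))

  descents : DescentsBelow c N (canonical a T)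
  descents i i+1<N same with position a i
  ... | inj₁ i<a with m≤n⇒m<n∨m≡n i<a
  ...   | inj₁ i+1<a = subst₂ _<_ (sym (canonical-head a T i+1<a)) (sym (canonical-head a T i<a))
                         (fill-descending a T i i+1<a)
  ...   | inj₂ i+1≡a = ⊥-elim (boundary i i+1≡a i+1<N same)
  descents _ i+1<N same | inj₂ (r , refl) =
    subst₂ _<_ (sym (trans (cong (canonical a T) (sym (+-suc a r))) (canonical-tail a T (suc r))))
               (sym (canonical-tail a T r))
               (entry-descending decreasing r (in-tail (subst (_< N) (sym (+-suc a r)) i+1<N)))

  good : GoodFun c L N (canonical a T)
  good = injective , descents , fixed-point-free

tailOf : ℕ → ℕ → (ℕ → ℕ) → List ℕ
tailOf a k f = applyUpTo (λ r → f (a + r)) k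

applyUpTo-linked : ∀ {R : ℕ → ℕ → Set} g k → (∀ r → suc r < k → R (g r) (g (suc r))) →
  Linked R (applyUpTo g k)
applyUpTo-linked g zero          _    = []
applyUpTo-linked g (suc zero)    _    = [-]
applyUpTo-linked g (suc (suc k)) step =
  step 0 (s≤s (s≤s z≤n)) ∷ applyUpTo-linked (λ r → g (suc r)) (suc k) (λ r r+1<k → step (suc r) (s≤s r+1<k))

module FromGood {c a k L} (blocks : TwoBlocks c a (a + k))
  (z : Vec (Fin (a + k)) (a + k)) (good-z : Good c L z) where

  open TwoBlocks blocks

  N : ℕ
  N = a + k
  f : ℕ → ℕ
  f = nth z
  T : List ℕ
  T = tailOf a k f

  good-f : GoodFun c L N f
  good-f = good⇒goodFun {c} {L} z good-z

  injective : InjectiveBelow N f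
  injective = proj₁ good-f
  descents : DescentsBelow c N f
  descents = proj₁ (proj₂ good-f)

  length-T : length T ≡ k
  length-T = length-applyUpTo (λ r → f (a + r)) k

  in-block : ∀ {r} → r < k → a + r < N
  in-block = +-monoʳ-< a

  head-descending : Descending a f
  head-descending i i+1<a = descents i (<-≤-trans i+1<a (m≤m+n a k)) (first-block i i+1<a)

  prefix : DescendingPrefix a T f
  prefix = record
    { descending = head-descending
    ; bounded    = λ i i<a → subst (suc (f i + i) ≤_) (cong (a +_) (sym length-T)) (begin
        suc (f i + i)    ≤⟨ s≤s (descent-level head-descending z≤n i<a) ⟩
        suc (f 0 + 0)    ≡⟨ cong suc (+-identityʳ (f 0)) ⟩
        suc (f 0)        ≤⟨ nth<N z 0 (<-≤-trans (≤-<-trans z≤n i<a) (m≤m+n a k)) ⟩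
        N                ∎)
    ; avoids     = λ i i<a fi∈T → let (r , r<k , fi≡far) = ∈-applyUpTo⁻ (λ r → f (a + r)) fi∈T in
        m+n≮m a r (subst (_< a) (injective i (a + r) (<-≤-trans i<a (m≤m+n a k)) (in-block r<k) fi≡far) i<a)
    }
    where open ≤-Reasoning

  decreasing : Linked _>_ T
  decreasing = applyUpTo-linked (λ r → f (a + r)) k λ r r+1<k →
    subst (λ j → f j < f (a + r)) (sym (+-suc a r))
      (descents (a + r) (subst (_< N) (+-suc a r) (in-block r+1<k))
        (second-block (a + r) (m≤m+n a r) (subst (_< N) (+-suc a r) (in-block r+1<k))))

  tail-bounded : All (_< N) T
  tail-bounded = applyUpTo⁺₁ (λ r → f (a + r)) k (λ r<k → nth<N z _ (in-block r<k))

  agrees : ∀ i → i < N → f i ≡ canonical a T i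
  agrees i i<N with position a i
  ... | inj₁ i<a = trans (value-from-level (descending-prefix-level T decreasing
                     (subst (λ M → All (_< M) T) (cong (a +_) (sym length-T)) tail-bounded) prefix i<a))
                     (sym (canonical-head a T i<a))
  ... | inj₂ (r , refl) = trans (sym (entry-applyUpTo (λ r → f (a + r)) k r (+-cancelˡ-< a r k i<N)))
                            (sym (canonical-tail a T r))

  valid : ValidTail a k L T
  valid = record
    { length-tail      = length-T
    ; decreasing       = decreasing
    ; tail-bounded     = tail-bounded
    ; fixed-point-free = λ i i<N i<L fixed →
        proj₂ (proj₂ good-f) i i<N i<L (trans (agrees i i<N) fixed)
    }

  is-canonical : z ≡ vecOf N (canonical a T)
  is-canonical = nth-ext z _ λ i i<N → trans (agrees i i<N)
    (sym (nth-vecOf N (canonical a T) i i<N (subst (_< N) (agrees i i<N) (nth<N z i i<N))))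

applyUpTo-cong : ∀ {g h : ℕ → ℕ} k → (∀ r → r < k → g r ≡ h r) → applyUpTo g k ≡ applyUpTo h k
applyUpTo-cong zero    _    = refl
applyUpTo-cong (suc k) same = cong₂ _∷_ (same 0 (s≤s z≤n)) (applyUpTo-cong k (λ r r<k → same (suc r) (s≤s r<k)))

-- Counting theorem for two-block compositions: Good vectors correspond to
-- valid tails, so any duplicate-free list of exactly the valid tails counts them.
#Good-two-blocks : ∀ {c a k L} → TwoBlocks c a (a + k) →
  (tails : List (List ℕ)) → Unique tails →
  (∀ T → T ∈ tails → ValidTail a k L T) → (∀ T → ValidTail a k L T → T ∈ tails) →
  #Good c L (a + k) ≡ length tails
#Good-two-blocks {c} {a} {k} {L} blocks tails unique sound complete = begin
  #Good c L N              ≡⟨ #Good-by-listing {c} {L} (map build tails) unique-vectors good-vectors all-good ⟩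
  length (map build tails) ≡⟨ length-map build tails ⟩
  length tails             ∎
  where
  open ≡-Reasoning
  N : ℕ
  N = a + k

  build : List ℕ → Vec (Fin N) N
  build T = vecOf N (canonical a T)

  read : Vec (Fin N) N → List ℕ
  read z = tailOf a k (nth z)

  read-build : ∀ T → ValidTail a k L T → read (build T) ≡ T
  read-build T valid = begin
    applyUpTo (λ r → nth (build T) (a + r)) k ≡⟨ applyUpTo-cong k (λ r r<k →
        trans (nth-vecOf N (canonical a T) (a + r) (+-monoʳ-< a r<k) (bounded (a + r) (+-monoʳ-< a r<k)))
              (canonical-tail a T r)) ⟩
    applyUpTo (entry T) k                     ≡⟨ cong (applyUpTo (entry T)) (sym length-tail) ⟩
    applyUpTo (entry T) (length T)            ≡⟨ applyUpTo-entry T ⟩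
    T                                         ∎
    where open Canonical blocks valid using (bounded)
          open ValidTail valid using (length-tail)

  unique-vectors : Unique (map build tails)
  unique-vectors = Unique.map⁻ (subst Unique (sym read∘build) unique)
    where
    read∘build : map read (map build tails) ≡ tails
    read∘build = trans (sym (map-∘ tails)) (map-id-local (All.tabulate λ {T} T∈ → read-build T (sound T T∈)))

  good-vectors : ∀ z → z ∈ map build tails → Good c L z
  good-vectors z z∈ with ∈-map⁻ build z∈
  ... | T , T∈ , refl = vecOf-good {c} {L} (canonical a T) (bounded) good
    where open Canonical blocks (sound T T∈) using (bounded; good)

  all-good : ∀ z → Good c L z → z ∈ map build tails
  all-good z good-z = subst (_∈ map build tails) (sym is-canonical) (∈-map⁺ build (complete T valid))
    where open FromGood blocks z good-z using (T; valid; is-canonical)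

blockOf-first : ∀ c cs {i} → i < c → blockOf (c ∷ cs) i ≡ 0
blockOf-first c cs {i} i<c with i <? c
... | yes _  = refl
... | no i≮c = ⊥-elim (i≮c i<c)

blockOf-later : ∀ c cs {i} → c ≤ i → blockOf (c ∷ cs) i ≡ suc (blockOf cs (i ∸ c))
blockOf-later c cs {i} c≤i with i <? c
... | yes i<c = ⊥-elim (<⇒≱ i<c c≤i)
... | no  _   = refl

two-blocks : ∀ a k cs → TwoBlocks (a ∷ k ∷ cs) a (a + k)
two-blocks a k cs = record
  { first-block  = λ i i+1<a → trans (blockOf-first a _ (<-trans (n<1+n i) i+1<a)) (sym (blockOf-first a _ i+1<a))
  ; second-block = λ i a≤i i+1<N → trans (second i a≤i (<-trans (n<1+n i) i+1<N))
                                      (sym (second (suc i) (m≤n⇒m≤1+n a≤i) i+1<N))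
  ; boundary     = λ i i+1≡a _ same → 0≢1+n (trans (sym (blockOf-first a _ (subst (i <_) i+1≡a (n<1+n i))))
                                        (trans same (trans (cong (blockOf (a ∷ k ∷ cs)) i+1≡a) (blockOf-later a _ ≤-refl))))
  }
  where
  second : ∀ i → a ≤ i → i < a + k → blockOf (a ∷ k ∷ cs) i ≡ 1
  second i a≤i i<N = trans (blockOf-later a _ a≤i)
    (cong suc (blockOf-first k cs (+-cancelˡ-< a (i ∸ a) k (subst (_< a + k) (sym (m+[n∸m]≡n a≤i)) i<N))))

-- Empty blocks in front shift every block index by one.
after-empty-block : ∀ {c a N} → TwoBlocks c a N → TwoBlocks (0 ∷ c) a N
after-empty-block {c} blocks = record
  { first-block  = λ i i+1<a → shifted (first-block i i+1<a)
  ; second-block = λ i a≤i i+1<N → shifted (second-block i a≤i i+1<N)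
  ; boundary     = λ i i+1≡a i+1<N same → boundary i i+1≡a i+1<N (suc-injective
      (trans (sym (blockOf-later 0 c z≤n)) (trans same (blockOf-later 0 c z≤n))))
  }
  where
  open TwoBlocks blocks
  shifted : ∀ {i j} → blockOf c i ≡ blockOf c j → blockOf (0 ∷ c) i ≡ blockOf (0 ∷ c) j
  shifted eq = trans (blockOf-later 0 c z≤n) (trans (cong suc eq) (sym (blockOf-later 0 c z≤n)))

fixed⇒level : ∀ a T {i} → i < a → canonical a T i ≡ i → suc (i + i) ≡ level a T i
fixed⇒level a T {i} i<a fixed =
  trans (cong (λ x → suc (x + i)) (sym (trans (sym (canonical-head a T i<a)) fixed))) (fill-level a T i<a)

level⇒fixed : ∀ a T {i} → i < a → suc (i + i) ≡ level a T i → canonical a T i ≡ i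
level⇒fixed a T {i} i<a lvl = trans (canonical-head a T i<a) (sym (value-from-level lvl))

double-injective : ∀ i j → i + i ≡ j + j → i ≡ j
double-injective zero    zero    _  = refl
double-injective (suc i) (suc j) eq =
  cong suc (double-injective i j (suc-injective (trans (sym (+-suc i i)) (trans (suc-injective eq) (+-suc j j)))))

odd≢even : ∀ i j → suc (i + i) ≢ j + j
odd≢even zero    (suc zero)    ()
odd≢even zero    (suc (suc j)) eq with suc-injective eq
... | ()
odd≢even (suc i) (suc j)       eq =
  odd≢even i j (suc-injective (trans (cong suc (sym (+-suc i i))) (trans (suc-injective eq) (+-suc j j))))

empty-tail : ∀ {a L T} → ValidTail a 0 L T → T ≡ []
empty-tail {T = []}    _     = refl
empty-tail {T = _ ∷ _} valid with ValidTail.length-tail valid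
... | ()

-- With an empty second block the only candidate is the reversal i ↦ a - 1 - i,
-- which is counted iff it has no fixed point below L.
#Good-reversal : ∀ {c a L} → TwoBlocks c a (a + 0) →
  FixedPointFreeBelow L (a + 0) (canonical a []) → #Good c L (a + 0) ≡ 1
#Good-reversal blocks fixed-point-free = #Good-two-blocks blocks ([] ∷ []) ([] ∷ [])
  (λ { T (here refl) → record { length-tail = refl ; decreasing = [] ; tail-bounded = []
                              ; fixed-point-free = fixed-point-free } })
  (λ T valid → here (empty-tail valid))

#Good-reversal-fixed : ∀ {c a L} → TwoBlocks c a (a + 0) →
  ¬ FixedPointFreeBelow L (a + 0) (canonical a []) → #Good c L (a + 0) ≡ 0
#Good-reversal-fixed {c} {a} {L} blocks has-fixed-point = #Good-two-blocks blocks [] [] (λ _ ())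
  λ T valid → ⊥-elim (has-fixed-point (subst (λ T → FixedPointFreeBelow L (a + 0) (canonical a T))
                                             (empty-tail valid) (ValidTail.fixed-point-free valid)))

-- G(2t, 1, 0): the valid tails are [ v ] with t ≤ v < 2t.
module SingleTail (t : ℕ) where

  a : ℕ
  a = t + t

  first-block-fixed : ∀ {v i} → i < a → canonical a [ v ] i ≡ i → v < t
  first-block-fixed {v} {i} i<a fixed with level-cases a v [] i
  ... | inj₁ (above , top) = +-cancelˡ-< t v t (subst (λ j → j + v < a) i≡t (≤-pred (subst (suc (i + v) <_) (+-comm a 1) above)))
    where
    i≡t : i ≡ t
    i≡t = double-injective i t (suc-injective (trans (fixed⇒level a [ v ] i<a fixed) (trans top (+-comm a 1))))
  ... | inj₂ (_ , rest) = ⊥-elim (odd≢even i t (trans (fixed⇒level a [ v ] i<a fixed) rest))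

  -- [ v ] is valid iff t ≤ v < 2t: a smaller v fixes position t, and v = 2t
  -- fixes position a.
  valid-if : ∀ {v} → t ≤ v → v < a → ValidTail a 1 (a + 1) [ v ]
  valid-if {v} t≤v v<a = record
    { length-tail      = refl
    ; decreasing       = [-]
    ; tail-bounded     = <-≤-trans v<a (m≤m+n a 1) ∷ []
    ; fixed-point-free = no-fixed-point
    }
    where
    no-fixed-point : FixedPointFreeBelow (a + 1) (a + 1) (canonical a [ v ])
    no-fixed-point i i<N _ fixed with position a i
    ... | inj₁ i<a = <⇒≱ (first-block-fixed i<a fixed) t≤v
    ... | inj₂ (zero , refl) = <-irrefl (trans (sym (canonical-tail a [ v ] 0)) fixed) (<-≤-trans v<a (m≤m+n a 0))
    ... | inj₂ (suc r , refl) = <⇒≱ (+-cancelˡ-< a (suc r) 1 i<N) (s≤s z≤n)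

  valid-only-if : ∀ {T} → ValidTail a 1 (a + 1) T → ∃ λ v → T ≡ [ v ] × t ≤ v × v < a
  valid-only-if {v ∷ []} valid = v , refl , t≤v , v<a
    where
    open ValidTail valid
    t≤v : t ≤ v
    t≤v = ≮⇒≥ λ v<t → fixed-point-free t (t<N v<t) (t<N v<t) (level⇒fixed a [ v ] (t<a v<t) (begin
      suc (t + t)  ≡⟨ +-comm a 1 ⟨
      a + 1        ≡⟨ level-top a v [] t (subst (suc (t + v) <_) (sym (+-comm a 1)) (s≤s (+-monoʳ-< t v<t))) ⟨
      level a [ v ] t ∎))
      where
      open ≡-Reasoning
      t<a : v < t → t < a
      t<a v<t = subst (_< a) (+-identityʳ t) (+-monoʳ-< t (≤-<-trans z≤n v<t))
      t<N : v < t → t < a + 1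
      t<N v<t = <-≤-trans (t<a v<t) (m≤m+n a 1)
    v<a : v < a
    v<a = ≤∧≢⇒< (≤-pred (subst (v <_) (+-comm a 1) (All.head tail-bounded))) λ v≡a →
      fixed-point-free (a + 0) (+-monoʳ-< a (s≤s z≤n)) (+-monoʳ-< a (s≤s z≤n))
        (trans (canonical-tail a [ v ] 0) (trans v≡a (sym (+-identityʳ a))))
  valid-only-if {[]}        valid with ValidTail.length-tail valid
  ... | ()
  valid-only-if {_ ∷ _ ∷ _} valid with ValidTail.length-tail valid
  ... | ()

  tails : List (List ℕ)
  tails = applyUpTo (λ r → [ t + r ]) t

  count : #Good (a ∷ 1 ∷ 0 ∷ 0 ∷ []) (a + 1) (a + 1) ≡ t
  count = trans (#Good-two-blocks (two-blocks a 1 _) tails unique sound complete) (length-applyUpTo _ t)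
    where
    unique : Unique tails
    unique = Unique.applyUpTo⁺₁ (λ r → [ t + r ]) t
      λ i<j _ eq → <⇒≢ i<j (+-cancelˡ-≡ t _ _ (∷-injectiveˡ eq))
    sound : ∀ T → T ∈ tails → ValidTail a 1 (a + 1) T
    sound T T∈ with ∈-applyUpTo⁻ (λ r → [ t + r ]) T∈
    ... | r , r<t , refl = valid-if (m≤m+n t r) (+-monoʳ-< t r<t)
    complete : ∀ T → ValidTail a 1 (a + 1) T → T ∈ tails
    complete T valid with valid-only-if valid
    ... | v , refl , t≤v , v<a = subst (λ x → [ x ] ∈ tails) (m+[n∸m]≡n t≤v)
          (∈-applyUpTo⁺ (λ r → [ t + r ]) (+-cancelˡ-< t (v ∸ t) t (subst (_< a) (sym (m+[n∸m]≡n t≤v)) v<a)))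

length-cartesianProductWith : ∀ {A B C : Set} (f : A → B → C) xs ys →
  length (cartesianProductWith f xs ys) ≡ length xs * length ys
length-cartesianProductWith f []       ys = refl
length-cartesianProductWith f (x ∷ xs) ys = begin
  length (map (f x) ys ++ cartesianProductWith f xs ys)              ≡⟨ length-++ (map (f x) ys) ⟩
  length (map (f x) ys) + length (cartesianProductWith f xs ys)     ≡⟨ cong₂ _+_ (length-map (f x) ys)
                                                                          (length-cartesianProductWith f xs ys) ⟩
  length ys + length xs * length ys                                 ∎
  where open ≡-Reasoning

-- G(2t + 1, 2, 0): the valid tails are [ u , w ] with w ≤ t and
-- u ∈ {t + 1, …, 2t, 2t + 2}.
module PairTail (t : ℕ) where

  a : ℕ
  a = suc (t + t)

  top-level : a + 2 ≡ suc (suc t + suc t)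
  top-level = cong suc (two-more t)
    where two-more : ∀ t → t + t + 2 ≡ suc (t + suc t)
          two-more = solve-∀

  middle-level : a + 1 ≡ suc (suc (t + t))
  middle-level = cong suc (+-comm (t + t) 1)

  -- A fixed point in the first block forces u ≤ t (at position t + 1)
  -- or w > t (at position t).
  fixed-level : ∀ {u w i} → suc (i + i) ≡ level a (u ∷ w ∷ []) i → u ≤ t ⊎ suc t ≤ w
  fixed-level {u} {w} {i} lvl with level-cases a u (w ∷ []) i
  ... | inj₁ (above , top) = inj₁ (s≤s⁻¹ (+-cancelˡ-< (suc t) u (suc t)
          (≤-pred (subst₂ (λ j M → suc (j + u) < M) i≡t+1 top-level above))))
    where
    i≡t+1 : i ≡ suc t
    i≡t+1 = double-injective i (suc t) (suc-injective (trans lvl (trans top top-level)))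
  ... | inj₂ (_ , rest) with level-cases a w [] i
  ...   | inj₁ (_ , top) = ⊥-elim (odd≢even t i (sym (suc-injective (trans lvl (trans rest (trans top middle-level))))))
  ...   | inj₂ (below , rest′) = inj₂ (+-cancelˡ-≤ t (suc t) w (subst (_≤ t + w) (sym (+-suc t t))
          (≤-pred (subst₂ (λ M j → M ≤ suc (j + w)) middle-level i≡t below))))
    where
    i≡t : i ≡ t
    i≡t = double-injective i t (suc-injective (trans lvl (trans rest rest′)))

  valid-if : ∀ {u w} → suc t ≤ u → u ≢ a → u < a + 2 → w ≤ t → ValidTail a 2 (a + 2) (u ∷ w ∷ [])
  valid-if {u} {w} t<u u≢a u<N w≤t = record
    { length-tail      = refl
    ; decreasing       = ≤-<-trans w≤t t<u ∷ [-]
    ; tail-bounded     = u<N ∷ w<N ∷ []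
    ; fixed-point-free = no-fixed-point
    }
    where
    w<N : w < a + 2
    w<N = <-≤-trans (s≤s (≤-trans w≤t (m≤m+n t t))) (m≤m+n a 2)
    no-fixed-point : FixedPointFreeBelow (a + 2) (a + 2) (canonical a (u ∷ w ∷ []))
    no-fixed-point i i<N _ fixed with position a i
    ... | inj₁ i<a = [ (λ u≤t → <⇒≱ t<u u≤t) , (λ t<w → <⇒≱ t<w w≤t) ]′
                       (fixed-level (fixed⇒level a (u ∷ w ∷ []) i<a fixed))
    ... | inj₂ (0 , refl) = u≢a (trans (sym (canonical-tail a (u ∷ w ∷ []) 0)) (trans fixed (+-identityʳ a)))
    ... | inj₂ (1 , refl) = <-irrefl (trans (sym (canonical-tail a (u ∷ w ∷ []) 1)) fixed)
                              (<-≤-trans (s≤s (≤-trans w≤t (m≤m+n t t))) (m≤m+n a 1))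
    ... | inj₂ (suc (suc r) , refl) = <⇒≱ (+-cancelˡ-< a (suc (suc r)) 2 i<N) (s≤s (s≤s z≤n))

  valid-only-if : ∀ {T} → ValidTail a 2 (a + 2) T →
    ∃ λ u → ∃ λ w → T ≡ u ∷ w ∷ [] × suc t ≤ u × u ≢ a × u < a + 2 × w ≤ t
  valid-only-if {u ∷ w ∷ []} valid = u , w , refl , t<u , u≢a , All.head tail-bounded , w≤t
    where
    open ValidTail valid
    T : List ℕ
    T = u ∷ w ∷ []
    w<u : w < u
    w<u = Linked.head decreasing
    in-range : ∀ {i} → i < a → i < a + 2
    in-range i<a = <-≤-trans i<a (m≤m+n a 2)
    u≢a : u ≢ a
    u≢a u≡a = fixed-point-free (a + 0) (+-monoʳ-< a (s≤s z≤n)) (+-monoʳ-< a (s≤s z≤n))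
      (trans (canonical-tail a T 0) (trans u≡a (sym (+-identityʳ a))))
    -- if u ≤ t, position t + 1 takes the top value t + 1
    t<u : suc t ≤ u
    t<u = ≰⇒> λ u≤t → fixed-point-free (suc t) (in-range (t+1<a u≤t)) (in-range (t+1<a u≤t))
      (level⇒fixed a T (t+1<a u≤t) (trans (sym top-level) (sym (level-top a u (w ∷ []) (suc t)
        (subst (suc (suc t + u) <_) (sym top-level) (s≤s (+-monoʳ-< (suc t) (s≤s u≤t))))))))
      where
      t+1<a : u ≤ t → suc t < a
      t+1<a u≤t = s≤s (subst (_≤ t + t) (+-comm t 1) (+-monoʳ-≤ t (<-≤-trans (≤-<-trans z≤n w<u) u≤t)))
    -- if w > t, position t takes the bottom value t
    w≤t : w ≤ t
    w≤t = ≮⇒≥ λ t<w → fixed-point-free t (in-range t<a) (in-range t<a) (level⇒fixed a T t<a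
      (sym (trans (level-rest a u (w ∷ []) t (u-passed t<w)) (level-rest a w [] t (w-passed t<w)))))
      where
      t<a : t < a
      t<a = s≤s (m≤m+n t t)
      w-passed : suc t ≤ w → a + 1 ≤ suc (t + w)
      w-passed t<w = subst (_≤ suc (t + w)) (sym middle-level)
        (s≤s (subst (_≤ t + w) (+-suc t t) (+-monoʳ-≤ t t<w)))
      u-passed : suc t ≤ w → a + 2 ≤ suc (t + u)
      u-passed t<w = subst (_≤ suc (t + u)) (sym top-level)
        (s≤s (subst (_≤ t + u) (+-suc t (suc t)) (+-monoʳ-≤ t (<-≤-trans (s≤s t<w) w<u))))
  valid-only-if {[]}            valid with ValidTail.length-tail valid
  ... | ()
  valid-only-if {_ ∷ []}        valid with ValidTail.length-tail valid
  ... | ()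
  valid-only-if {_ ∷ _ ∷ _ ∷ _} valid with ValidTail.length-tail valid
  ... | ()

  upper : List ℕ
  upper = (a + 1) ∷ applyUpTo (λ r → suc t + r) t

  upper-sound : ∀ {u} → u ∈ upper → suc t ≤ u × u ≢ a × u < a + 2
  upper-sound (here refl) = ≤-trans (s≤s (m≤m+n t t)) (m≤m+n a 1) , (λ eq → <-irrefl (sym eq) (m<m+n a (s≤s z≤n)))
                          , +-monoʳ-< a (s≤s (s≤s z≤n))
  upper-sound (there u∈) with ∈-applyUpTo⁻ (λ r → suc t + r) u∈
  ... | r , r<t , refl = m≤m+n (suc t) r , <⇒≢ (+-monoʳ-< (suc t) r<t) , <-≤-trans (+-monoʳ-< (suc t) r<t) (m≤m+n a 2)

  upper-complete : ∀ {u} → suc t ≤ u → u ≢ a → u < a + 2 → u ∈ upper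
  upper-complete {u} t<u u≢a u<N with u <? a
  ... | yes u<a = there (subst (_∈ applyUpTo (λ r → suc t + r) t) (m+[n∸m]≡n t<u)
                    (∈-applyUpTo⁺ (λ r → suc t + r) (+-cancelˡ-< (suc t) (u ∸ suc t) t
                      (subst (_< a) (sym (m+[n∸m]≡n t<u)) u<a))))
  ... | no  u≮a = here (≤-antisym
                    (subst (u ≤_) (+-comm 1 a) (≤-pred (subst (u <_) (+-comm a 2) u<N)))
                    (subst (_≤ u) (+-comm 1 a) (≤∧≢⇒< (≮⇒≥ u≮a) (λ a≡u → u≢a (sym a≡u)))))

  upper-unique : Unique upper
  upper-unique = applyUpTo⁺₁ (λ r → suc t + r) t
                   (λ r<t eq → <-irrefl (sym eq) (<-trans (+-monoʳ-< (suc t) r<t) (m<m+n a (s≤s z≤n))))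
               ∷ Unique.applyUpTo⁺₁ (λ r → suc t + r) t (λ i<j _ → <⇒≢ (+-monoʳ-< (suc t) i<j))

  pair : ℕ → ℕ → List ℕ
  pair u w = u ∷ w ∷ []

  tails : List (List ℕ)
  tails = cartesianProductWith pair upper (upTo (suc t))

  count : #Good (a ∷ 2 ∷ 0 ∷ 0 ∷ []) (a + 2) (a + 2) ≡ suc t * suc t
  count = begin
    #Good (a ∷ 2 ∷ 0 ∷ 0 ∷ []) (a + 2) (a + 2) ≡⟨ #Good-two-blocks (two-blocks a 2 _) tails unique sound complete ⟩
    length tails                                ≡⟨ length-cartesianProductWith pair upper (upTo (suc t)) ⟩
    suc (length (applyUpTo (λ r → suc t + r) t)) * length (upTo (suc t))
                                                ≡⟨ cong₂ (λ m n → suc m * n) (length-applyUpTo _ t) (length-upTo (suc t)) ⟩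
    suc t * suc t                               ∎
    where
    open ≡-Reasoning
    unique : Unique tails
    unique = Unique.cartesianProductWith⁺ pair (λ eq → ∷-injectiveˡ eq , ∷-injectiveˡ (∷-injectiveʳ eq))
               upper-unique (Unique.upTo⁺ (suc t))
    sound : ∀ T → T ∈ tails → ValidTail a 2 (a + 2) T
    sound T T∈ with ∈-cartesianProductWith⁻ pair upper (upTo (suc t)) T∈
    ... | u , w , u∈ , w∈ , refl = let (t<u , u≢a , u<N) = upper-sound u∈ in
                                   valid-if t<u u≢a u<N (s≤s⁻¹ (∈-upTo⁻ w∈))
    complete : ∀ T → ValidTail a 2 (a + 2) T → T ∈ tails
    complete T valid with valid-only-if valid
    ... | u , w , refl , t<u , u≢a , u<N , w≤t =
          ∈-cartesianProductWith⁺ pair (upper-complete t<u u≢a u<N) (∈-upTo⁺ (s≤s w≤t))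

-- With s = 0 only m = 0 contributes: the composition (a₁, a₂, 0, 0).
G-first-two-blocks : ∀ a k → G a k 0 ≡ #Good (a ∷ k ∷ 0 ∷ 0 ∷ []) (a + k) (a + k)
G-first-two-blocks a k = trans (+-identityʳ _)
  (cong (#Good (a ∷ k ∷ 0 ∷ 0 ∷ []) (a + k)) (trans (+-identityʳ (a + k + 0)) (+-identityʳ (a + k))))

sum-last : ∀ (h : ℕ → ℕ) n → (∀ m → m < n → h m ≡ 0) → sum (applyUpTo h (suc n)) ≡ h n
sum-last h zero    _    = +-identityʳ (h 0)
sum-last h (suc n) vanish = trans (cong (_+ sum (applyUpTo (λ m → h (suc m)) (suc n))) (vanish 0 (s≤s z≤n)))
  (sum-last (λ m → h (suc m)) n (λ m m<n → vanish (suc m) (s≤s m<n)))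

-- With a₂ = 0 and s = a₁ only m = a₁ contributes: the composition (0, 0, a₁, 0).
G-third-block : ∀ a → G a 0 a ≡ #Good (0 ∷ 0 ∷ a ∷ 0 ∷ []) 0 (a + 0)
G-third-block a = trans (cong sum (map-upTo (term a 0 a) (suc a)))
  (trans (sum-last (term a 0 a) a term-before) term-last)
  where
  term-before : ∀ m → m < a → term a 0 a m ≡ 0
  term-before m m<a with m ≤? a | a ∸ m ≤? 0
  ... | yes _ | yes a∸m≤0 = ⊥-elim (<⇒≱ (m<n⇒0<n∸m m<a) a∸m≤0)
  ... | yes _ | no  _     = refl
  ... | no  _ | _         = refl
  term-last : term a 0 a a ≡ #Good (0 ∷ 0 ∷ a ∷ 0 ∷ []) 0 (a + 0)
  term-last with a ≤? a | a ∸ a ≤? 0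
  ... | yes _ | yes _  rewrite n∸n≡0 a = refl
  ... | yes _ | no a∸a≰0 = ⊥-elim (a∸a≰0 (≤-reflexive (n∸n≡0 a)))
  ... | no a≰a | _      = ⊥-elim (a≰a ≤-refl)

G-even-0-0 : ∀ t → G (t + t) 0 0 ≡ 1
G-even-0-0 t = trans (G-first-two-blocks (t + t) 0) (#Good-reversal (two-blocks (t + t) 0 _)
  λ i i<N _ fixed → odd≢even i t (fixed⇒level (t + t) [] (subst (i <_) (+-identityʳ (t + t)) i<N) fixed))

G-odd-0-0 : ∀ t → G (suc (t + t)) 0 0 ≡ 0
G-odd-0-0 t = trans (G-first-two-blocks a 0) (#Good-reversal-fixed (two-blocks a 0 _)
  λ fixed-point-free → fixed-point-free t t<N t<N (level⇒fixed a [] (s≤s (m≤m+n t t)) refl))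
  where
  a : ℕ
  a = suc (t + t)
  t<N : t < a + 0
  t<N = subst (t <_) (sym (+-identityʳ a)) (s≤s (m≤m+n t t))

G-0-a : ∀ a → G a 0 a ≡ 1
G-0-a a = trans (G-third-block a)
  (#Good-reversal (after-empty-block (after-empty-block (two-blocks a 0 _))) (λ _ _ ()))

G-even-1-0 : ∀ t → G (t + t) 1 0 ≡ t
G-even-1-0 t = trans (G-first-two-blocks (t + t) 1) (SingleTail.count t)

G-odd-2-0 : ∀ t → G (suc (t + t)) 2 0 ≡ suc t * suc t
G-odd-2-0 t = trans (G-first-two-blocks (suc (t + t)) 2) (PairTail.count t)

double : ∀ t → t * 2 ≡ t + t
double = solve-∀

even-half : ∀ {a} → a % 2 ≡ 0 → a ≡ a / 2 + a / 2
even-half {a} even = trans (m≡m%n+[m/n]*n a 2) (trans (cong (_+ a / 2 * 2) even) (double (a / 2)))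

odd-half : ∀ {a} → a % 2 ≡ 1 → a ≡ suc (a / 2 + a / 2)
odd-half {a} odd = trans (m≡m%n+[m/n]*n a 2) (trans (cong (_+ a / 2 * 2) odd) (cong suc (double (a / 2))))

half-of-next : ∀ t → (suc (t + t) + 1) / 2 ≡ suc t
half-of-next t = trans (cong (_/ 2) (sym (next t))) (m*n/n≡m (suc t) 2)
  where next : ∀ t → suc t * 2 ≡ suc (t + t) + 1
        next = solve-∀

lemma6 : (a₁ : ℕ) →
    (a₁ % 2 ≡ 1 → G a₁ 0 0 ≡ 0) ×
    (a₁ % 2 ≡ 0 → G a₁ 0 0 ≡ 1) ×
    (G a₁ 0 a₁ ≡ 1) ×
    (a₁ % 2 ≡ 0 → G a₁ 1 0 ≡ a₁ / 2) ×
    (a₁ % 2 ≡ 1 → G a₁ 2 0 ≡ ((a₁ + 1) / 2) ^ 2)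
lemma6 a₁ =
  (λ odd  → subst (λ a → G a 0 0 ≡ 0) (sym (odd-half {a₁} odd)) (G-odd-0-0 t)) ,
  (λ even → subst (λ a → G a 0 0 ≡ 1) (sym (even-half {a₁} even)) (G-even-0-0 t)) ,
  G-0-a a₁ ,
  (λ even → subst (λ a → G a 1 0 ≡ t) (sym (even-half {a₁} even)) (G-even-1-0 t)) ,
  (λ odd  → begin
    G a₁ 2 0                       ≡⟨ cong (λ a → G a 2 0) (odd-half {a₁} odd) ⟩
    G (suc (t + t)) 2 0            ≡⟨ G-odd-2-0 t ⟩
    suc t * suc t                  ≡⟨ cong (suc t *_) (*-identityʳ (suc t)) ⟨
    suc t ^ 2                      ≡⟨ cong (_^ 2) (half-of-next t) ⟨
    ((suc (t + t) + 1) / 2) ^ 2    ≡⟨ cong (λ a → ((a + 1) / 2) ^ 2) (odd-half {a₁} odd) ⟨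
    ((a₁ + 1) / 2) ^ 2             ∎)
  where
  open ≡-Reasoning
  t : ℕ
  t = a₁ / 2
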